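{- There is an effective method which, given a unary predicate $p$ and a $\mathsf{MON}$ formula $F$, computes a formula $F'$ such that: (1) $F'$ is a $\mathsf{QMON}_=$ formula; (2) $F' \equiv \exists p\, F$; (3) $p$ is the only quantified predicate in $F'$; (4) all occurrences of $p$ in $F'$ are within positive occurrences of subformulas of the form \[\exists p\, \Big( \bigwedge_{1 \leq i \leq a} \forall x\, (A_i[x] \lor px) \land \bigwedge_{1 \leq i \leq b} \forall x\, (B_i[x] \lor \lnot px) \land \bigwedge_{1 \leq i \leq c} \exists x\, (C_i[x] \land px) \land \bigwedge_{1 \leq i \leq d} \exists x\, (D_i[x] \land \lnot px)\Big),\] where $a, b, c, d \geq 0$ are natural numbers and the $A_i[x], B_i[x], C_i[x], D_i[x]$ are formulas in which $p$ does not occur; (5) every free individual variable, every constant and every predicate occurring in $F'$ also occurs in $F$.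
   Context: $\mathsf{MON}$ is the class of first-order formulas without equality whose predicates are nullary or unary, which may contain constants but no function symbols of positive arity, and which may contain free individual variables. $\mathsf{MON}_=$ is the same class with equality allowed, and $\mathsf{QMON}_=$ is $\mathsf{MON}_=$ extended by second-order quantification upon predicates. A subformula occurrence is positive if it lies within the scope of an even number of negations. $G \equiv H$ means same truth value in every interpretation under every assignment. -}

module Defs where

open import Data.Nat using (ℕ; _≟_)
open import Data.Bool using (Bool; true; false; not)
open import Data.List using (List; []; _∷_; map; foldr)
open import Data.List.Relation.Unary.All using (All)
open import Data.Product using (Σ; _×_; _,_; proj₁; proj₂)
open import Data.Sum using (_⊎_)
open import Data.Unit using (⊤)
open import Data.Empty using (⊥)
open import Relation.Nullary using (¬_; yes; no)
open import Relation.Binary.PropositionalEquality using (_≡_)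

Var : Set
Var = ℕ

Const : Set
Const = ℕ

UPred : Set
UPred = ℕ

NPred : Set
NPred = ℕ

data Term : Set where
  var : Var → Term
  con : Const → Term

data Fm : Set where
  tt   : Fm
  ff   : Fm
  nat  : NPred → Fm
  uat  : UPred → Term → Fm
  eqf  : Term → Term → Fm
  neg  : Fm → Fm
  andf : Fm → Fm → Fm
  orf  : Fm → Fm → Fm
  allf : Var → Fm → Fm
  exf  : Var → Fm → Fm
  all2 : UPred → Fm → Fm
  ex2  : UPred → Fm → Fm

MON : Fm → Set
MON tt = ⊤
MON ff = ⊤
MON (nat _) = ⊤
MON (uat _ _) = ⊤
MON (eqf _ _) = ⊥
MON (neg F) = MON F
MON (andf F G) = MON F × MON G
MON (orf F G) = MON F × MON G
MON (allf _ F) = MON F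
MON (exf _ F) = MON F
MON (all2 _ _) = ⊥
MON (ex2 _ _) = ⊥

UOcc : UPred → Fm → Set
UOcc q tt = ⊥
UOcc q ff = ⊥
UOcc q (nat _) = ⊥
UOcc q (uat r _) = q ≡ r
UOcc q (eqf _ _) = ⊥
UOcc q (neg F) = UOcc q F
UOcc q (andf F G) = UOcc q F ⊎ UOcc q G
UOcc q (orf F G) = UOcc q F ⊎ UOcc q G
UOcc q (allf _ F) = UOcc q F
UOcc q (exf _ F) = UOcc q F
UOcc q (all2 r F) = q ≡ r ⊎ UOcc q F
UOcc q (ex2 r F) = q ≡ r ⊎ UOcc q F

NOcc : NPred → Fm → Set
NOcc q tt = ⊥
NOcc q ff = ⊥
NOcc q (nat r) = q ≡ r
NOcc q (uat _ _) = ⊥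
NOcc q (eqf _ _) = ⊥
NOcc q (neg F) = NOcc q F
NOcc q (andf F G) = NOcc q F ⊎ NOcc q G
NOcc q (orf F G) = NOcc q F ⊎ NOcc q G
NOcc q (allf _ F) = NOcc q F
NOcc q (exf _ F) = NOcc q F
NOcc q (all2 _ F) = NOcc q F
NOcc q (ex2 _ F) = NOcc q F

COccT : Const → Term → Set
COccT c (var _) = ⊥
COccT c (con d) = c ≡ d

COcc : Const → Fm → Set
COcc c tt = ⊥
COcc c ff = ⊥
COcc c (nat _) = ⊥
COcc c (uat _ t) = COccT c t
COcc c (eqf s t) = COccT c s ⊎ COccT c t
COcc c (neg F) = COcc c F
COcc c (andf F G) = COcc c F ⊎ COcc c G
COcc c (orf F G) = COcc c F ⊎ COcc c G
COcc c (allf _ F) = COcc c F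
COcc c (exf _ F) = COcc c F
COcc c (all2 _ F) = COcc c F
COcc c (ex2 _ F) = COcc c F

FreeT : Var → Term → Set
FreeT x (var y) = x ≡ y
FreeT x (con _) = ⊥

Free : Var → Fm → Set
Free x tt = ⊥
Free x ff = ⊥
Free x (nat _) = ⊥
Free x (uat _ t) = FreeT x t
Free x (eqf s t) = FreeT x s ⊎ FreeT x t
Free x (neg F) = Free x F
Free x (andf F G) = Free x F ⊎ Free x G
Free x (orf F G) = Free x F ⊎ Free x G
Free x (allf y F) = ¬ (x ≡ y) × Free x F
Free x (exf y F) = ¬ (x ≡ y) × Free x F
Free x (all2 _ F) = Free x F
Free x (ex2 _ F) = Free x F

OnlyQ : UPred → Fm → Set
OnlyQ p tt = ⊤
OnlyQ p ff = ⊤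
OnlyQ p (nat _) = ⊤
OnlyQ p (uat _ _) = ⊤
OnlyQ p (eqf _ _) = ⊤
OnlyQ p (neg F) = OnlyQ p F
OnlyQ p (andf F G) = OnlyQ p F × OnlyQ p G
OnlyQ p (orf F G) = OnlyQ p F × OnlyQ p G
OnlyQ p (allf _ F) = OnlyQ p F
OnlyQ p (exf _ F) = OnlyQ p F
OnlyQ p (all2 q F) = q ≡ p × OnlyQ p F
OnlyQ p (ex2 q F) = q ≡ p × OnlyQ p F

⋀ : List Fm → Fm
⋀ = foldr andf tt

-- Each A_i comes with the variable x it is quantified upon.
Block : UPred → (As Bs Cs Ds : List (Var × Fm)) → Fm
Block p As Bs Cs Ds =
  ex2 p (andf (⋀ (map (λ xA → allf (proj₁ xA) (orf (proj₂ xA) (uat p (var (proj₁ xA))))) As))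
        (andf (⋀ (map (λ xB → allf (proj₁ xB) (orf (proj₂ xB) (neg (uat p (var (proj₁ xB)))))) Bs))
        (andf (⋀ (map (λ xC → exf (proj₁ xC) (andf (proj₂ xC) (uat p (var (proj₁ xC))))) Cs))
              (⋀ (map (λ xD → exf (proj₁ xD) (andf (proj₂ xD) (neg (uat p (var (proj₁ xD)))))) Ds)))))

NoP : UPred → Var × Fm → Set
NoP p xA = ¬ UOcc p (proj₂ xA)

IsBlock : UPred → Fm → Set
IsBlock p F = Σ (List (Var × Fm)) λ As → Σ (List (Var × Fm)) λ Bs →
              Σ (List (Var × Fm)) λ Cs → Σ (List (Var × Fm)) λ Ds →
              All (NoP p) As × All (NoP p) Bs × All (NoP p) Cs × All (NoP p) Ds ×
              F ≡ Block p As Bs Cs Ds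

-- Within p s F : every occurrence of p in F lies within an occurrence of a
-- block subformula that is positive, where s = true means that F itself
-- occurs positively (even number of enclosing negations).
data Within (p : UPred) : Bool → Fm → Set where
  absent : ∀ {s F} → ¬ UOcc p F → Within p s F
  block  : ∀ {F} → IsBlock p F → Within p true F
  neg    : ∀ {s F} → Within p (not s) F → Within p s (neg F)
  andf   : ∀ {s F G} → Within p s F → Within p s G → Within p s (andf F G)
  orf    : ∀ {s F G} → Within p s F → Within p s G → Within p s (orf F G)
  allf   : ∀ {s x F} → Within p s F → Within p s (allf x F)
  exf    : ∀ {s x F} → Within p s F → Within p s (exf x F)
  all2   : ∀ {s q F} → ¬ (q ≡ p) → Within p s F → Within p s (all2 q F)
  ex2    : ∀ {s q F} → ¬ (q ≡ p) → Within p s F → Within p s (ex2 q F)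

upd : {A : Set} → (ℕ → A) → ℕ → A → ℕ → A
upd f n a m with m ≟ n
... | yes _ = a
... | no _ = f m

record Interp (D : Set) : Set where
  field
    icon : Const → D
    iupr : UPred → D → Bool
    inpr : NPred → Bool
open Interp public

setU : {D : Set} → Interp D → UPred → (D → Bool) → Interp D
setU I q P = record { icon = icon I ; iupr = upd (iupr I) q P ; inpr = inpr I }

evalT : {D : Set} → Interp D → (Var → D) → Term → D
evalT I ρ (var x) = ρ x
evalT I ρ (con c) = icon I c

Sat : {D : Set} → Interp D → (Var → D) → Fm → Set
Sat I ρ tt = ⊤
Sat I ρ ff = ⊥
Sat I ρ (nat q) = inpr I q ≡ true
Sat I ρ (uat q t) = iupr I q (evalT I ρ t) ≡ true
Sat I ρ (eqf s t) = evalT I ρ s ≡ evalT I ρ t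
Sat I ρ (neg F) = ¬ Sat I ρ F
Sat I ρ (andf F G) = Sat I ρ F × Sat I ρ G
Sat I ρ (orf F G) = Sat I ρ F ⊎ Sat I ρ G
Sat {D} I ρ (allf x F) = (d : D) → Sat I (upd ρ x d) F
Sat {D} I ρ (exf x F) = Σ D λ d → Sat I (upd ρ x d) F
Sat {D} I ρ (all2 q F) = (P : D → Bool) → Sat (setU I q P) ρ F
Sat {D} I ρ (ex2 q F) = Σ (D → Bool) λ P → Sat (setU I q P) ρ F

-- G ≡ H : same truth value in every interpretation under every assignment
-- (the domain is nonempty since an assignment Var → D exists).
Equiv : Fm → Fm → Set₁
Equiv G H = (D : Set) (I : Interp D) (ρ : Var → D) →
            (Sat I ρ G → Sat I ρ H) × (Sat I ρ H → Sat I ρ G)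

-- Quantifier elimination for monadic logic puts F into disjunctive normal form over nullary
-- atoms, unary atoms q t and types ∃x ⋀ ±q x.  Since ∃p commutes with ∨, it suffices to treat
-- one clause.  There every literal mentioning p becomes a block conjunct: a type with
-- p-literals ±p x becomes ∃x (B ∧ ±p x), its negation ∀x (¬B ∨ ∓p x), and p t becomes
-- ∃y (y = t ∧ p y).  The remaining literals do not mention p, so they move out of ∃p, and
-- each clause yields one block.

module Submission where

open import Defs
open import Level using (0ℓ)
open import Axiom.ExcludedMiddle using (ExcludedMiddle)
open import Data.Nat using (ℕ; suc; _≟_)
open import Data.Nat.Properties using (1+n≢n)
open import Data.Bool using (Bool; true; false; not)
open import Data.Maybe using (Maybe; just; nothing)
open import Data.List using (List; []; _∷_; [_]; _++_; map; foldr; cartesianProductWith)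
open import Data.List.Relation.Unary.All as All using (All; []; _∷_)
open import Data.List.Relation.Unary.Any as Any using (Any; here; there)
import Data.List.Relation.Unary.All.Properties as Allₚ
import Data.List.Relation.Unary.Any.Properties as Anyₚ
open import Data.Product using (Σ; _×_; _,_; proj₁; proj₂)
open import Data.Product.Function.Dependent.Propositional using (congˡ)
open import Data.Product.Function.NonDependent.Propositional using (_×-⇔_)
open import Data.Sum using (_⊎_; inj₁; inj₂; [_,_]′; map₂)
open import Data.Sum.Function.Propositional using (_⊎-⇔_)
open import Data.Unit using (⊤; tt)
open import Data.Empty using (⊥; ⊥-elim)
open import Function.Base using (_∘_; id)
open import Function.Bundles using (_⇔_; mk⇔; Equivalence)
open import Function.Related.Propositional using (equivalence; K-reflexive; module EquationalReasoning)
open import Function.Construct.Composition using (_⇔-∘_)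
open import Function.Construct.Identity using (⇔-id)
open import Function.Construct.Symmetry using (⇔-sym)
open import Function.Related.TypeIsomorphisms using (¬-cong-⇔)
open import Relation.Nullary using (¬_; yes; no; Dec)
open import Relation.Nullary.Decidable using (decidable-stable; _⊎-dec_)
open import Relation.Binary.PropositionalEquality
  using (_≡_; _≢_; refl; sym; trans; cong; cong₂; subst)

open Equivalence using (to; from)

≡⇒⇔ : {A B : Set} → A ≡ B → A ⇔ B
≡⇒⇔ = K-reflexive {k = equivalence}

Σ-⇔ : {X : Set} {A B : X → Set} → (∀ x → A x ⇔ B x) → Σ X A ⇔ Σ X B
Σ-⇔ e = congˡ {k = equivalence} (λ {x} → e x)

Π-⇔ : {X : Set} {A B : X → Set} → (∀ x → A x ⇔ B x) → ((x : X) → A x) ⇔ ((x : X) → B x)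
Π-⇔ e = mk⇔ (λ f x → to (e x) (f x)) (λ g x → from (e x) (g x))

¬∃¬⇔∀ : ExcludedMiddle 0ℓ → {D : Set} {P : D → Set} → (¬ Σ D λ d → ¬ P d) ⇔ ((d : D) → P d)
¬∃¬⇔∀ em = mk⇔
  (λ ¬∃¬ d → decidable-stable em λ ¬Pd → ¬∃¬ (d , ¬Pd))
  (λ ∀P (d , ¬Pd) → ¬Pd (∀P d))

upd-≡ : {A : Set} (f : ℕ → A) (n : ℕ) (a : A) → upd f n a n ≡ a
upd-≡ f n a with n ≟ n
... | yes _ = refl
... | no n≢n = ⊥-elim (n≢n refl)

upd-≢ : {A : Set} (f : ℕ → A) {n m : ℕ} (a : A) → m ≢ n → upd f n a m ≡ f m
upd-≢ f {n} {m} a m≢n with m ≟ n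
... | yes m≡n = ⊥-elim (m≢n m≡n)
... | no _ = refl

All-cong : {X : Set} {P Q : X → Set} → (∀ x → P x ⇔ Q x) → {xs : List X} → All P xs ⇔ All Q xs
All-cong e = mk⇔ (All.map (to (e _))) (All.map (from (e _)))

Any-cong : {X : Set} {P Q : X → Set} → (∀ x → P x ⇔ Q x) → {xs : List X} → Any P xs ⇔ Any Q xs
Any-cong e = mk⇔ (Any.map (to (e _))) (Any.map (from (e _)))

-- Coincidence lemma

record AgreeExcept {D : Set} (p : UPred) (I J : Interp D) : Set where
  field
    icon≡ : ∀ c → icon I c ≡ icon J c
    inpr≡ : ∀ q → inpr I q ≡ inpr J q
    iupr≡ : ∀ q → q ≢ p → ∀ d → iupr I q d ≡ iupr J q d

module _ {D : Set} {p : UPred} where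
  open AgreeExcept

  setU-agreeExcept : (I : Interp D) (P : D → Bool) → AgreeExcept p (setU I p P) I
  setU-agreeExcept I P = record
    { icon≡ = λ _ → refl
    ; inpr≡ = λ _ → refl
    ; iupr≡ = λ q q≢p d → cong (λ f → f d) (upd-≢ (iupr I) P q≢p)
    }

  setU-agreeExcept-cong : {I J : Interp D} (q : UPred) (Q : D → Bool) →
                          AgreeExcept p I J → AgreeExcept p (setU I q Q) (setU J q Q)
  setU-agreeExcept-cong {I} {J} q Q I≈J = record
    { icon≡ = icon≡ I≈J ; inpr≡ = inpr≡ I≈J ; iupr≡ = updated }
    where
    updated : ∀ r → r ≢ p → ∀ d → upd (iupr I) q Q r d ≡ upd (iupr J) q Q r d
    updated r r≢p d with r ≟ q
    ... | yes _ = refl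
    ... | no _ = iupr≡ I≈J r r≢p d

  evalT-agreeExcept : {I J : Interp D} → AgreeExcept p I J → (ρ : Var → D) (t : Term) →
                      evalT I ρ t ≡ evalT J ρ t
  evalT-agreeExcept I≈J ρ (var x) = refl
  evalT-agreeExcept I≈J ρ (con c) = icon≡ I≈J c

  Sat-agreeExcept : {I J : Interp D} → AgreeExcept p I J → (F : Fm) → ¬ UOcc p F →
                    (ρ : Var → D) → Sat I ρ F ⇔ Sat J ρ F
  Sat-agreeExcept I≈J tt p∉F ρ = ≡⇒⇔ refl
  Sat-agreeExcept I≈J ff p∉F ρ = ≡⇒⇔ refl
  Sat-agreeExcept I≈J (nat q) p∉F ρ = ≡⇒⇔ (cong (_≡ true) (inpr≡ I≈J q))
  Sat-agreeExcept {I} {J} I≈J (uat q t) p∉F ρ = ≡⇒⇔ (cong (_≡ true) (begin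
    iupr I q (evalT I ρ t) ≡⟨ iupr≡ I≈J q (p∉F ∘ sym) _ ⟩
    iupr J q (evalT I ρ t) ≡⟨ cong (iupr J q) (evalT-agreeExcept I≈J ρ t) ⟩
    iupr J q (evalT J ρ t) ∎))
    where open Relation.Binary.PropositionalEquality.≡-Reasoning
  Sat-agreeExcept I≈J (eqf s t) p∉F ρ =
    ≡⇒⇔ (cong₂ _≡_ (evalT-agreeExcept I≈J ρ s) (evalT-agreeExcept I≈J ρ t))
  Sat-agreeExcept I≈J (neg F) p∉F ρ = ¬-cong-⇔ (Sat-agreeExcept I≈J F p∉F ρ)
  Sat-agreeExcept I≈J (andf F G) p∉F ρ =
    Sat-agreeExcept I≈J F (p∉F ∘ inj₁) ρ ×-⇔ Sat-agreeExcept I≈J G (p∉F ∘ inj₂) ρ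
  Sat-agreeExcept I≈J (orf F G) p∉F ρ =
    Sat-agreeExcept I≈J F (p∉F ∘ inj₁) ρ ⊎-⇔ Sat-agreeExcept I≈J G (p∉F ∘ inj₂) ρ
  Sat-agreeExcept I≈J (allf x F) p∉F ρ = Π-⇔ λ d → Sat-agreeExcept I≈J F p∉F (upd ρ x d)
  Sat-agreeExcept I≈J (exf x F) p∉F ρ = Σ-⇔ λ d → Sat-agreeExcept I≈J F p∉F (upd ρ x d)
  Sat-agreeExcept I≈J (all2 q F) p∉F ρ = Π-⇔ λ Q →
    Sat-agreeExcept (setU-agreeExcept-cong q Q I≈J) F (p∉F ∘ inj₂) ρ
  Sat-agreeExcept I≈J (ex2 q F) p∉F ρ = Σ-⇔ λ Q →
    Sat-agreeExcept (setU-agreeExcept-cong q Q I≈J) F (p∉F ∘ inj₂) ρ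

Signed : Bool → Set → Set
Signed true A = A
Signed false A = ¬ A

signed : Bool → Fm → Fm
signed true F = F
signed false F = neg F

⋁ : List Fm → Fm
⋁ = foldr orf ff

Sat-signed : {D : Set} (I : Interp D) (ρ : Var → D) (b : Bool) (F : Fm) →
             Sat I ρ (signed b F) ≡ Signed b (Sat I ρ F)
Sat-signed I ρ true F = refl
Sat-signed I ρ false F = refl

Signed-not : ExcludedMiddle 0ℓ → (b : Bool) (A : Set) → Signed (not b) A ⇔ (¬ Signed b A)
Signed-not em true A = ≡⇒⇔ refl
Signed-not em false A = mk⇔ (λ a ¬a → ¬a a) (decidable-stable em)

data Symbol : Set where
  ivar  : Var → Symbol
  const : Const → Symbol
  upred : UPred → Symbol
  npred : NPred → Symbol

Occurs : Symbol → Fm → Set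
Occurs (ivar x) = Free x
Occurs (const c) = COcc c
Occurs (upred q) = UOcc q
Occurs (npred q) = NOcc q

_⊑_ : Fm → Fm → Set
F ⊑ G = ∀ s → Occurs s F → Occurs s G

_⊑_∪_ : Fm → Fm → UPred → Set
F ⊑ G ∪ p = ∀ s → Occurs s F → s ≡ upred p ⊎ Occurs s G

Occurs-tt : ∀ s → ¬ Occurs s tt
Occurs-tt (ivar _) ()
Occurs-tt (const _) ()
Occurs-tt (upred _) ()
Occurs-tt (npred _) ()

Occurs-ff : ∀ s → ¬ Occurs s ff
Occurs-ff (ivar _) ()
Occurs-ff (const _) ()
Occurs-ff (upred _) ()
Occurs-ff (npred _) ()

Occurs-neg : ∀ s F → Occurs s (neg F) ≡ Occurs s F
Occurs-neg (ivar _) F = refl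
Occurs-neg (const _) F = refl
Occurs-neg (upred _) F = refl
Occurs-neg (npred _) F = refl

Occurs-signed : ∀ s b F → Occurs s (signed b F) ≡ Occurs s F
Occurs-signed s true F = refl
Occurs-signed s false F = Occurs-neg s F

Occurs-andf : ∀ s F G → Occurs s (andf F G) ≡ (Occurs s F ⊎ Occurs s G)
Occurs-andf (ivar _) F G = refl
Occurs-andf (const _) F G = refl
Occurs-andf (upred _) F G = refl
Occurs-andf (npred _) F G = refl

Occurs-orf : ∀ s F G → Occurs s (orf F G) ≡ (Occurs s F ⊎ Occurs s G)
Occurs-orf (ivar _) F G = refl
Occurs-orf (const _) F G = refl
Occurs-orf (upred _) F G = refl
Occurs-orf (npred _) F G = refl

Occurs-allf : ∀ s x F → Occurs s (allf x F) ≡ Occurs s (exf x F)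
Occurs-allf (ivar _) x F = refl
Occurs-allf (const _) x F = refl
Occurs-allf (upred _) x F = refl
Occurs-allf (npred _) x F = refl

⊑-andfˡ : ∀ {F G} → F ⊑ andf F G
⊑-andfˡ {F} {G} s o = subst id (sym (Occurs-andf s F G)) (inj₁ o)

⊑-andfʳ : ∀ {F G} → G ⊑ andf F G
⊑-andfʳ {F} {G} s o = subst id (sym (Occurs-andf s F G)) (inj₂ o)

⊑-orfˡ : ∀ {F G} → F ⊑ orf F G
⊑-orfˡ {F} {G} s o = subst id (sym (Occurs-orf s F G)) (inj₁ o)

⊑-orfʳ : ∀ {F G} → G ⊑ orf F G
⊑-orfʳ {F} {G} s o = subst id (sym (Occurs-orf s F G)) (inj₂ o)

andf-⊑ : ∀ {F G H} → F ⊑ H → G ⊑ H → andf F G ⊑ H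
andf-⊑ {F} {G} F⊑H G⊑H s o = [ F⊑H s , G⊑H s ]′ (subst id (Occurs-andf s F G) o)

exf-mono : ∀ {x F G} → F ⊑ G → exf x F ⊑ exf x G
exf-mono F⊑G (ivar y) (y≢x , o) = y≢x , F⊑G (ivar y) o
exf-mono F⊑G (const c) o = F⊑G (const c) o
exf-mono F⊑G (upred q) o = F⊑G (upred q) o
exf-mono F⊑G (npred q) o = F⊑G (npred q) o

⊑-exf : ∀ {x F G} → F ⊑ G → ¬ Free x F → F ⊑ exf x G
⊑-exf {x} {F} F⊑G x∉F (ivar y) o = (λ y≡x → x∉F (subst (λ z → Free z F) y≡x o)) , F⊑G (ivar y) o
⊑-exf F⊑G x∉F (const c) o = F⊑G (const c) o
⊑-exf F⊑G x∉F (upred q) o = F⊑G (upred q) o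
⊑-exf F⊑G x∉F (npred q) o = F⊑G (npred q) o

⊑∪-trans : ∀ {p F G H} → F ⊑ G ∪ p → G ⊑ H → F ⊑ H ∪ p
⊑∪-trans F⊑G G⊑H s o = map₂ (G⊑H s) (F⊑G s o)

andf-⊑∪ : ∀ {p F G H} → F ⊑ H ∪ p → G ⊑ H ∪ p → andf F G ⊑ H ∪ p
andf-⊑∪ {F = F} {G} F⊑H G⊑H s o = [ F⊑H s , G⊑H s ]′ (subst id (Occurs-andf s F G) o)

orf-⊑∪ : ∀ {p F G H} → F ⊑ H ∪ p → G ⊑ H ∪ p → orf F G ⊑ H ∪ p
orf-⊑∪ {F = F} {G} F⊑H G⊑H s o = [ F⊑H s , G⊑H s ]′ (subst id (Occurs-orf s F G) o)

ex2-⊑∪ : ∀ {p F G} → F ⊑ G ∪ p → ex2 p F ⊑ G ∪ p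
ex2-⊑∪ F⊑G (ivar x) o = F⊑G (ivar x) o
ex2-⊑∪ F⊑G (const c) o = F⊑G (const c) o
ex2-⊑∪ F⊑G (upred q) (inj₁ q≡p) = inj₁ (cong upred q≡p)
ex2-⊑∪ F⊑G (upred q) (inj₂ o) = F⊑G (upred q) o
ex2-⊑∪ F⊑G (npred q) o = F⊑G (npred q) o

⋀-⊑∪ : ∀ {p G} (Fs : List Fm) → All (λ F → F ⊑ G ∪ p) Fs → ⋀ Fs ⊑ G ∪ p
⋀-⊑∪ [] [] s o = ⊥-elim (Occurs-tt s o)
⋀-⊑∪ (F ∷ Fs) (h ∷ hs) = andf-⊑∪ h (⋀-⊑∪ Fs hs)

⋁-⊑∪ : ∀ {p G} (Fs : List Fm) → All (λ F → F ⊑ G ∪ p) Fs → ⋁ Fs ⊑ G ∪ p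
⋁-⊑∪ [] [] s o = ⊥-elim (Occurs-ff s o)
⋁-⊑∪ (F ∷ Fs) (h ∷ hs) = orf-⊑∪ h (⋁-⊑∪ Fs hs)

-- Disjunctive normal form

-- ∃type L stands for the sentence ∃x ⋀ ±q x over (±, q) ∈ L; in a literal, true means positive
data Basic : Set where
  nullary : NPred → Basic
  unary   : UPred → Term → Basic
  ∃type   : List (Bool × UPred) → Basic

Literal : Set
Literal = Bool × Basic

Clause : Set
Clause = List Literal

DNF : Set
DNF = List Clause

negate : Literal → Literal
negate (b , u) = not b , u

_∧ᴰ_ : DNF → DNF → DNF
_∧ᴰ_ = cartesianProductWith _++_

¬ᴰ_ : DNF → DNF
¬ᴰ [] = [ [] ]
¬ᴰ (c ∷ d) = map ([_] ∘ negate) c ∧ᴰ (¬ᴰ d)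

atVar : Var → Basic → Maybe UPred
atVar x (nullary _) = nothing
atVar x (unary q (var y)) with y ≟ x
... | yes _ = just q
... | no _ = nothing
atVar x (unary q (con _)) = nothing
atVar x (∃type _) = nothing

typeAt : Var → Clause → List (Bool × UPred)
typeAt x [] = []
typeAt x ((b , u) ∷ c) with atVar x u
... | just q = (b , q) ∷ typeAt x c
... | nothing = typeAt x c

awayFrom : Var → Clause → Clause
awayFrom x [] = []
awayFrom x ((b , u) ∷ c) with atVar x u
... | just _ = awayFrom x c
... | nothing = (b , u) ∷ awayFrom x c

-- x can occur in a literal only as an atom q x, so ∃x distributes over the clause this way
∃ᶜ : Var → Clause → Clause
∃ᶜ x c = (true , ∃type (typeAt x c)) ∷ awayFrom x c

∃ᴰ : Var → DNF → DNF
∃ᴰ x = map (∃ᶜ x)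

-- equality and second-order quantifiers are outside MON; dnf sends them to an arbitrary value
dnf : Fm → DNF
dnf tt = [ [] ]
dnf ff = []
dnf (nat q) = [ [ true , nullary q ] ]
dnf (uat q t) = [ [ true , unary q t ] ]
dnf (eqf _ _) = []
dnf (neg F) = ¬ᴰ dnf F
dnf (andf F G) = dnf F ∧ᴰ dnf G
dnf (orf F G) = dnf F ++ dnf G
dnf (allf x F) = ¬ᴰ ∃ᴰ x (¬ᴰ dnf F)
dnf (exf x F) = ∃ᴰ x (dnf F)
dnf (all2 _ _) = []
dnf (ex2 _ _) = []

module _ {D : Set} (I : Interp D) where

  HoldsAt : D → Bool × UPred → Set
  HoldsAt d (b , q) = Signed b (iupr I q d ≡ true)

  SatB : (Var → D) → Basic → Set
  SatB ρ (nullary q) = inpr I q ≡ true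
  SatB ρ (unary q t) = iupr I q (evalT I ρ t) ≡ true
  SatB ρ (∃type L) = Σ D λ d → All (HoldsAt d) L

  SatL : (Var → D) → Literal → Set
  SatL ρ (b , u) = Signed b (SatB ρ u)

  SatC : (Var → D) → Clause → Set
  SatC ρ = All (SatL ρ)

  SatD : (Var → D) → DNF → Set
  SatD ρ = Any (SatC ρ)

module _ {D : Set} {I : Interp D} where

  SatD-∧ᴰ : (ρ : Var → D) (d e : DNF) → SatD I ρ (d ∧ᴰ e) ⇔ (SatD I ρ d × SatD I ρ e)
  SatD-∧ᴰ ρ d e = mk⇔
    (Anyₚ.cartesianProductWith⁻ _++_ (Allₚ.++⁻ _) d e)
    (λ (d✓ , e✓) → Anyₚ.cartesianProductWith⁺ _++_ Allₚ.++⁺ d✓ e✓)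

  SatD-¬ᴰ : ExcludedMiddle 0ℓ → (ρ : Var → D) (d : DNF) → SatD I ρ (¬ᴰ d) ⇔ (¬ SatD I ρ d)
  SatD-¬ᴰ em ρ [] = mk⇔ (λ _ ()) (λ _ → here [])
  SatD-¬ᴰ em ρ (c ∷ d) = mk⇔
    (λ s → let (c✗ , d✗) = to (SatD-∧ᴰ ρ (map ([_] ∘ negate) c) (¬ᴰ d)) s in
           λ { (here c✓) → to negated c✗ c✓ ; (there d✓) → to (SatD-¬ᴰ em ρ d) d✗ d✓ })
    (λ ¬cd → from (SatD-∧ᴰ ρ (map ([_] ∘ negate) c) (¬ᴰ d))
               (from negated (¬cd ∘ here) , from (SatD-¬ᴰ em ρ d) (¬cd ∘ there)))
    where
    negate-sound : (l : Literal) → SatC I ρ [ negate l ] ⇔ (¬ SatL I ρ l)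
    negate-sound (b , u) = mk⇔
      (λ { (s ∷ []) → to (Signed-not em b _) s })
      (λ s → from (Signed-not em b _) s ∷ [])
    negated : SatD I ρ (map ([_] ∘ negate) c) ⇔ (¬ SatC I ρ c)
    negated = mk⇔
      (Allₚ.Any¬⇒¬All ∘ Any.map (to (negate-sound _)) ∘ Anyₚ.map⁻)
      (Anyₚ.map⁺ ∘ Any.map (from (negate-sound _)) ∘ Allₚ.¬All⇒Any¬ (λ _ → em) c)

  SatB-atVar-just : (ρ : Var → D) (x : Var) (d : D) (u : Basic) {q : UPred} →
                    atVar x u ≡ just q → SatB I (upd ρ x d) u ≡ (iupr I q d ≡ true)
  -- upd ρ x d y is computed by the same test y ≟ x
  SatB-atVar-just ρ x d (unary q (var y)) eq with y ≟ x | eq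
  ... | yes _ | refl = refl
  ... | no _ | ()

  SatB-atVar-nothing : (ρ : Var → D) (x : Var) (d : D) (u : Basic) →
                       atVar x u ≡ nothing → SatB I (upd ρ x d) u ≡ SatB I ρ u
  SatB-atVar-nothing ρ x d (nullary q) eq = refl
  SatB-atVar-nothing ρ x d (unary q (var y)) eq with y ≟ x | eq
  ... | yes _ | ()
  ... | no _ | refl = refl
  SatB-atVar-nothing ρ x d (unary q (con c)) eq = refl
  SatB-atVar-nothing ρ x d (∃type L) eq = refl

  SatC-split : (ρ : Var → D) (x : Var) (d : D) (c : Clause) →
               SatC I (upd ρ x d) c ⇔ (All (HoldsAt I d) (typeAt x c) × SatC I ρ (awayFrom x c))
  SatC-split ρ x d [] = mk⇔ (λ _ → [] , []) (λ _ → [])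
  SatC-split ρ x d ((b , u) ∷ c) with atVar x u in eq
  ... | just q = mk⇔
    (λ { (s ∷ ss) → let (t , r) = to (SatC-split ρ x d c) ss in subst (Signed b) at-x s ∷ t , r })
    (λ { (s ∷ t , r) → subst (Signed b) (sym at-x) s ∷ from (SatC-split ρ x d c) (t , r) })
    where at-x = SatB-atVar-just ρ x d u eq
  ... | nothing = mk⇔
    (λ { (s ∷ ss) → let (t , r) = to (SatC-split ρ x d c) ss in t , subst (Signed b) away s ∷ r })
    (λ { (t , s ∷ r) → subst (Signed b) (sym away) s ∷ from (SatC-split ρ x d c) (t , r) })
    where away = SatB-atVar-nothing ρ x d u eq

  SatC-∃ᶜ : (ρ : Var → D) (x : Var) (c : Clause) →
            SatC I ρ (∃ᶜ x c) ⇔ Σ D λ d → SatC I (upd ρ x d) c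
  SatC-∃ᶜ ρ x c = mk⇔
    (λ { ((d , t) ∷ r) → d , from (SatC-split ρ x d c) (t , r) })
    (λ (d , s) → let (t , r) = to (SatC-split ρ x d c) s in (d , t) ∷ r)

  SatD-∃ᴰ : (ρ : Var → D) (x : Var) (cs : DNF) →
            SatD I ρ (∃ᴰ x cs) ⇔ Σ D λ d → SatD I (upd ρ x d) cs
  SatD-∃ᴰ ρ x cs = mk⇔
    (Anyₚ.Any-Σ⁻ʳ ∘ Any.map (to (SatC-∃ᶜ ρ x _)) ∘ Anyₚ.map⁻)
    (Anyₚ.map⁺ ∘ Any.map (from (SatC-∃ᶜ ρ x _)) ∘ Anyₚ.Any-Σ⁺ʳ)

  SatD-++ : (ρ : Var → D) (d e : DNF) → SatD I ρ (d ++ e) ⇔ (SatD I ρ d ⊎ SatD I ρ e)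
  SatD-++ ρ d e = mk⇔ (Anyₚ.++⁻ d)
    λ { (inj₁ d✓) → Anyₚ.++⁺ˡ d✓ ; (inj₂ e✓) → Anyₚ.++⁺ʳ d e✓ }

  SatD-dnf : ExcludedMiddle 0ℓ → (ρ : Var → D) (F : Fm) → MON F → SatD I ρ (dnf F) ⇔ Sat I ρ F
  SatD-dnf em ρ tt _ = mk⇔ (λ _ → tt) (λ _ → here [])
  SatD-dnf em ρ ff _ = mk⇔ (λ ()) (λ ())
  SatD-dnf em ρ (nat q) _ = mk⇔ (λ { (here (s ∷ [])) → s ; (there ()) }) (λ s → here (s ∷ []))
  SatD-dnf em ρ (uat q t) _ = mk⇔ (λ { (here (s ∷ [])) → s ; (there ()) }) (λ s → here (s ∷ []))
  SatD-dnf em ρ (neg F) m = ¬-cong-⇔ (SatD-dnf em ρ F m) ⇔-∘ SatD-¬ᴰ em ρ (dnf F)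
  SatD-dnf em ρ (andf F G) (mF , mG) =
    (SatD-dnf em ρ F mF ×-⇔ SatD-dnf em ρ G mG) ⇔-∘ SatD-∧ᴰ ρ (dnf F) (dnf G)
  SatD-dnf em ρ (orf F G) (mF , mG) =
    (SatD-dnf em ρ F mF ⊎-⇔ SatD-dnf em ρ G mG) ⇔-∘ SatD-++ ρ (dnf F) (dnf G)
  SatD-dnf em ρ (exf x F) m = Σ-⇔ (λ d → SatD-dnf em (upd ρ x d) F m) ⇔-∘ SatD-∃ᴰ ρ x (dnf F)
  SatD-dnf em ρ (allf x F) m = begin
    SatD I ρ (¬ᴰ ∃ᴰ x (¬ᴰ dnf F))               ∼⟨ SatD-¬ᴰ em ρ _ ⟩
    (¬ SatD I ρ (∃ᴰ x (¬ᴰ dnf F)))              ∼⟨ ¬-cong-⇔ (SatD-∃ᴰ ρ x _) ⟩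
    (¬ Σ D λ d → SatD I (upd ρ x d) (¬ᴰ dnf F)) ∼⟨ ¬-cong-⇔ (Σ-⇔ λ d → SatD-¬ᴰ em (upd ρ x d) _) ⟩
    (¬ Σ D λ d → ¬ SatD I (upd ρ x d) (dnf F))  ∼⟨ ¬-cong-⇔ (Σ-⇔ λ d → ¬-cong-⇔ (ih d)) ⟩
    (¬ Σ D λ d → ¬ Sat I (upd ρ x d) F)         ∼⟨ ¬∃¬⇔∀ em ⟩
    ((d : D) → Sat I (upd ρ x d) F)             ∎
    where
    open EquationalReasoning
    ih : (d : D) → SatD I (upd ρ x d) (dnf F) ⇔ Sat I (upd ρ x d) F
    ih d = SatD-dnf em (upd ρ x d) F m

atom₀ : Bool × UPred → Fm
atom₀ (b , q) = signed b (uat q (var 0))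

typeF : List (Bool × UPred) → Fm
typeF L = ⋀ (map atom₀ L)

renderB : Basic → Fm
renderB (nullary q) = nat q
renderB (unary q t) = uat q t
renderB (∃type L) = exf 0 (typeF L)

render : Literal → Fm
render (b , u) = signed b (renderB u)

Signed-cong : (b : Bool) {A B : Set} → A ⇔ B → Signed b A ⇔ Signed b B
Signed-cong true A⇔B = A⇔B
Signed-cong false A⇔B = ¬-cong-⇔ A⇔B

module _ {D : Set} {I : Interp D} where

  Sat-⋀ : (ρ : Var → D) (Fs : List Fm) → Sat I ρ (⋀ Fs) ⇔ All (Sat I ρ) Fs
  Sat-⋀ ρ [] = mk⇔ (λ _ → []) (λ _ → tt)
  Sat-⋀ ρ (F ∷ Fs) = mk⇔
    (λ (s , ss) → s ∷ to (Sat-⋀ ρ Fs) ss)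
    (λ { (s ∷ ss) → s , from (Sat-⋀ ρ Fs) ss })

  Sat-⋀-map : {X : Set} (f : X → Fm) (ρ : Var → D) (xs : List X) →
              Sat I ρ (⋀ (map f xs)) ⇔ All (Sat I ρ ∘ f) xs
  Sat-⋀-map f ρ xs = mk⇔ Allₚ.map⁻ Allₚ.map⁺ ⇔-∘ Sat-⋀ ρ (map f xs)

  Sat-⋁ : (ρ : Var → D) (Fs : List Fm) → Sat I ρ (⋁ Fs) ⇔ Any (Sat I ρ) Fs
  Sat-⋁ ρ [] = mk⇔ (λ ()) (λ ())
  Sat-⋁ ρ (F ∷ Fs) = mk⇔
    (λ { (inj₁ s) → here s ; (inj₂ s) → there (to (Sat-⋁ ρ Fs) s) })
    (λ { (here s) → inj₁ s ; (there s) → inj₂ (from (Sat-⋁ ρ Fs) s) })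

  Sat-typeF : (ρ : Var → D) (d : D) (L : List (Bool × UPred)) →
              Sat I (upd ρ 0 d) (typeF L) ⇔ All (HoldsAt I d) L
  Sat-typeF ρ d L = mk⇔ (All.map (to atom)) (All.map (from atom)) ⇔-∘ Sat-⋀-map atom₀ (upd ρ 0 d) L
    where
    atom : {e : Bool × UPred} → Sat I (upd ρ 0 d) (atom₀ e) ⇔ HoldsAt I d e
    atom {b , q} = ≡⇒⇔ (Sat-signed I (upd ρ 0 d) b (uat q (var 0)))

  Sat-render : (ρ : Var → D) (l : Literal) → Sat I ρ (render l) ⇔ SatL I ρ l
  Sat-render ρ (b , u) = Signed-cong b (Sat-renderB u) ⇔-∘ ≡⇒⇔ (Sat-signed I ρ b (renderB u))
    where
    Sat-renderB : (u : Basic) → Sat I ρ (renderB u) ⇔ SatB I ρ u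
    Sat-renderB (nullary q) = ≡⇒⇔ refl
    Sat-renderB (unary q t) = ≡⇒⇔ refl
    Sat-renderB (∃type L) = Σ-⇔ λ d → Sat-typeF ρ d L

_⊑ᴰ_ : DNF → Fm → Set
d ⊑ᴰ F = All (All (λ l → render l ⊑ F)) d

⊑ᴰ-mono : ∀ {d F G} → d ⊑ᴰ F → F ⊑ G → d ⊑ᴰ G
⊑ᴰ-mono d⊑F F⊑G = All.map (All.map (λ l⊑F s → F⊑G s ∘ l⊑F s)) d⊑F

∧ᴰ-⊑ᴰ : ∀ {F} (d e : DNF) → d ⊑ᴰ F → e ⊑ᴰ F → (d ∧ᴰ e) ⊑ᴰ F
∧ᴰ-⊑ᴰ [] e [] e⊑F = []
∧ᴰ-⊑ᴰ (c ∷ d) e (c⊑F ∷ d⊑F) e⊑F =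
  Allₚ.++⁺ (Allₚ.map⁺ (All.map (Allₚ.++⁺ c⊑F) e⊑F)) (∧ᴰ-⊑ᴰ d e d⊑F e⊑F)

negate-⊑ : ∀ {F} (l : Literal) → render l ⊑ F → render (negate l) ⊑ F
negate-⊑ (b , u) l⊑F s o =
  l⊑F s (subst id (sym (Occurs-signed s b _)) (subst id (Occurs-signed s (not b) _) o))

¬ᴰ-⊑ᴰ : ∀ {F} (d : DNF) → d ⊑ᴰ F → (¬ᴰ d) ⊑ᴰ F
¬ᴰ-⊑ᴰ [] [] = [] ∷ []
¬ᴰ-⊑ᴰ (c ∷ d) (c⊑F ∷ d⊑F) =
  ∧ᴰ-⊑ᴰ (map ([_] ∘ negate) c) (¬ᴰ d)
    (Allₚ.map⁺ (All.map (λ {l} l⊑F → negate-⊑ l l⊑F ∷ []) c⊑F)) (¬ᴰ-⊑ᴰ d d⊑F)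

typeF-occurs : ∀ s (L : List (Bool × UPred)) → Occurs s (typeF L) →
               Any (λ e → Occurs s (uat (proj₂ e) (var 0))) L
typeF-occurs s [] o = ⊥-elim (Occurs-tt s o)
typeF-occurs s ((b , q) ∷ L) o with subst id (Occurs-andf s _ _) o
... | inj₁ o′ = here (subst id (Occurs-signed s b _) o′)
... | inj₂ o′ = there (typeF-occurs s L o′)

∃typeF-occurs : ∀ s (L : List (Bool × UPred)) → Occurs s (exf 0 (typeF L)) →
                Σ UPred λ q → s ≡ upred q × Any (λ e → q ≡ proj₂ e) L
∃typeF-occurs (ivar y) L (y≢0 , o) = ⊥-elim (y≢0 (proj₂ (Any.satisfied (typeF-occurs (ivar y) L o))))
∃typeF-occurs (const c) L o = ⊥-elim (proj₂ (Any.satisfied (typeF-occurs (const c) L o)))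
∃typeF-occurs (upred q) L o = q , refl , typeF-occurs (upred q) L o
∃typeF-occurs (npred n) L o = ⊥-elim (proj₂ (Any.satisfied (typeF-occurs (npred n) L o)))

atVar-just-occurs : ∀ {x q} (u : Basic) → atVar x u ≡ just q → UOcc q (renderB u)
atVar-just-occurs {x} (unary r (var y)) eq with y ≟ x | eq
... | yes _ | refl = refl

atVar-nothing-¬Free : ∀ {x} (u : Basic) → atVar x u ≡ nothing → ¬ Free x (renderB u)
atVar-nothing-¬Free (nullary q) eq ()
atVar-nothing-¬Free {x} (unary q (var y)) eq with y ≟ x | eq
... | no y≢x | refl = λ x≡y → y≢x (sym x≡y)
atVar-nothing-¬Free (unary q (con c)) eq ()
atVar-nothing-¬Free {x} (∃type L) eq o with ∃typeF-occurs (ivar x) L o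
... | _ , () , _

module _ {F : Fm} (x : Var) where

  typeAt-occurs : ∀ {q} (c : Clause) → Any (λ e → q ≡ proj₂ e) (typeAt x c) → Any (λ l → UOcc q (render l)) c
  typeAt-occurs ((b , u) ∷ c) i with atVar x u in eq | i
  ... | just q | here refl = here (subst id (sym (Occurs-signed (upred q) b _)) (atVar-just-occurs u eq))
  ... | just q | there i′ = there (typeAt-occurs c i′)
  ... | nothing | i′ = there (typeAt-occurs c i′)

  typeAt-⊑ : (c : Clause) → All (λ l → render l ⊑ F) c → exf 0 (typeF (typeAt x c)) ⊑ exf x F
  typeAt-⊑ c c⊑F s o with ∃typeF-occurs s (typeAt x c) o
  ... | q , refl , i = let (l⊑F , o′) = All.lookupAny c⊑F (typeAt-occurs c i) in l⊑F (upred q) o′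

  awayFrom-⊑ : (c : Clause) → All (λ l → render l ⊑ F) c → All (λ l → render l ⊑ exf x F) (awayFrom x c)
  awayFrom-⊑ [] [] = []
  awayFrom-⊑ ((b , u) ∷ c) (l⊑F ∷ c⊑F) with atVar x u in eq
  ... | just _ = awayFrom-⊑ c c⊑F
  ... | nothing =
    ⊑-exf l⊑F (atVar-nothing-¬Free u eq ∘ subst id (Occurs-signed (ivar x) b _)) ∷ awayFrom-⊑ c c⊑F

  ∃ᴰ-⊑ᴰ : (d : DNF) → d ⊑ᴰ F → (∃ᴰ x d) ⊑ᴰ exf x F
  ∃ᴰ-⊑ᴰ d d⊑F = Allₚ.map⁺ (All.map (λ {c} c⊑F → typeAt-⊑ c c⊑F ∷ awayFrom-⊑ c c⊑F) d⊑F)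

dnf-⊑ᴰ : (F : Fm) → dnf F ⊑ᴰ F
dnf-⊑ᴰ tt = [] ∷ []
dnf-⊑ᴰ ff = []
dnf-⊑ᴰ (nat q) = ((λ s o → o) ∷ []) ∷ []
dnf-⊑ᴰ (uat q t) = ((λ s o → o) ∷ []) ∷ []
dnf-⊑ᴰ (eqf _ _) = []
dnf-⊑ᴰ (neg F) = ¬ᴰ-⊑ᴰ (dnf F) (⊑ᴰ-mono (dnf-⊑ᴰ F) (λ s → subst id (sym (Occurs-neg s F))))
dnf-⊑ᴰ (andf F G) =
  ∧ᴰ-⊑ᴰ (dnf F) (dnf G) (⊑ᴰ-mono (dnf-⊑ᴰ F) ⊑-andfˡ) (⊑ᴰ-mono (dnf-⊑ᴰ G) ⊑-andfʳ)
dnf-⊑ᴰ (orf F G) = Allₚ.++⁺ (⊑ᴰ-mono (dnf-⊑ᴰ F) ⊑-orfˡ) (⊑ᴰ-mono (dnf-⊑ᴰ G) ⊑-orfʳ)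
dnf-⊑ᴰ (allf x F) =
  ¬ᴰ-⊑ᴰ _ (⊑ᴰ-mono (∃ᴰ-⊑ᴰ x _ (¬ᴰ-⊑ᴰ (dnf F) (dnf-⊑ᴰ F))) (λ s → subst id (sym (Occurs-allf s x F))))
dnf-⊑ᴰ (exf x F) = ∃ᴰ-⊑ᴰ x (dnf F) (dnf-⊑ᴰ F)
dnf-⊑ᴰ (all2 _ _) = []
dnf-⊑ᴰ (ex2 _ _) = []

-- Eliminating p from a clause

-- ∀∨ true, ∀∨ false, ∃∧ true, ∃∧ false are the conjunct shapes A, B, C, D of a block
data Piece : Set where
  plain : Fm → Piece
  ∀∨    : Bool → Var × Fm → Piece
  ∃∧    : Bool → Var × Fm → Piece

pieceF : UPred → Piece → Fm
pieceF p (plain G) = G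
pieceF p (∀∨ b (x , A)) = allf x (orf A (signed b (uat p (var x))))
pieceF p (∃∧ b (x , A)) = exf x (andf A (signed b (uat p (var x))))

data Polarity : Set where
  unused : Polarity
  only   : Bool → Polarity
  clash  : Polarity

addSign : Bool → Polarity → Polarity
addSign b unused = only b
addSign true (only true) = only true
addSign false (only false) = only false
addSign true (only false) = clash
addSign false (only true) = clash
addSign b clash = clash

polarity : UPred → List (Bool × UPred) → Polarity
polarity p [] = unused
polarity p ((b , q) ∷ L) with q ≟ p
... | yes _ = addSign b (polarity p L)
... | no _ = polarity p L

without : UPred → List (Bool × UPred) → List (Bool × UPred)
without p [] = []
without p ((b , q) ∷ L) with q ≟ p
... | yes _ = without p L
... | no _ = (b , q) ∷ without p L

Compatible : Polarity → Bool → Set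
Compatible unused v = ⊤
Compatible (only b) v = Signed b (v ≡ true)
Compatible clash v = ⊥

fresh : Term → Var
fresh (var y) = suc y
fresh (con _) = 0

-- B is the type of x without its p-literals; contradictory p-literals make the type empty
pieceEx : Bool → Polarity → Fm → Piece
pieceEx true unused B = plain (exf 0 B)
pieceEx false unused B = plain (neg (exf 0 B))
pieceEx true (only s) B = ∃∧ s (0 , B)
pieceEx false (only s) B = ∀∨ (not s) (0 , neg B)
pieceEx true clash B = plain ff
pieceEx false clash B = plain tt

piece : UPred → Literal → Piece
piece p (b , nullary q) = plain (render (b , nullary q))
piece p (b , unary q t) with q ≟ p
... | yes _ = ∃∧ b (fresh t , eqf (var (fresh t)) t)
... | no _ = plain (render (b , unary q t))
piece p (b , ∃type L) = pieceEx b (polarity p L) (typeF (without p L))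

Compatible-addSign : (b : Bool) (π : Polarity) (v : Bool) →
                     (Signed b (v ≡ true) × Compatible π v) ⇔ Compatible (addSign b π) v
Compatible-addSign b unused v = mk⇔ proj₁ (_, tt)
Compatible-addSign true (only true) v = mk⇔ proj₁ (λ s → s , s)
Compatible-addSign false (only false) v = mk⇔ proj₁ (λ s → s , s)
Compatible-addSign true (only false) v = mk⇔ (λ (s , ¬s) → ¬s s) λ ()
Compatible-addSign false (only true) v = mk⇔ (λ (¬s , s) → ¬s s) λ ()
Compatible-addSign b clash v = mk⇔ proj₂ λ ()

module _ {D : Set} {J : Interp D} (p : UPred) where

  HoldsAt-without : (d : D) (L : List (Bool × UPred)) →
                    All (HoldsAt J d) L ⇔ (All (HoldsAt J d) (without p L) × Compatible (polarity p L) (iupr J p d))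
  HoldsAt-without d [] = mk⇔ (λ _ → [] , tt) (λ _ → [])
  HoldsAt-without d ((b , q) ∷ L) with q ≟ p
  ... | yes refl = mk⇔
    (λ { (h ∷ hs) → let (r , k) = to (HoldsAt-without d L) hs in r , to add (h , k) })
    (λ (r , k) → let (h , k′) = from add k in h ∷ from (HoldsAt-without d L) (r , k′))
    where add = Compatible-addSign b (polarity q L) (iupr J q d)
  ... | no _ = mk⇔
    (λ { (h ∷ hs) → let (r , k) = to (HoldsAt-without d L) hs in h ∷ r , k })
    (λ { (h ∷ r , k) → h ∷ from (HoldsAt-without d L) (r , k) })

  Sat-pieceEx-true : (ρ : Var → D) (π : Polarity) (B : Fm) →
    Sat J ρ (pieceF p (pieceEx true π B)) ⇔ Σ D λ d → Sat J (upd ρ 0 d) B × Compatible π (iupr J p d)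
  Sat-pieceEx-true ρ unused B = mk⇔ (λ (d , s) → d , s , tt) (λ (d , s , _) → d , s)
  Sat-pieceEx-true ρ (only s) B = Σ-⇔ λ d → ⇔-id _ ×-⇔ ≡⇒⇔ (Sat-signed J (upd ρ 0 d) s (uat p (var 0)))
  Sat-pieceEx-true ρ clash B = mk⇔ (λ ()) (λ ())

  Sat-pieceEx-false : ExcludedMiddle 0ℓ → (ρ : Var → D) (π : Polarity) (B : Fm) →
    Sat J ρ (pieceF p (pieceEx false π B)) ⇔ (¬ Sat J ρ (pieceF p (pieceEx true π B)))
  Sat-pieceEx-false em ρ unused B = ⇔-id _
  Sat-pieceEx-false em ρ (only s) B = deMorgan ⇔-∘ Π-⇔ λ d → ⇔-id _ ⊎-⇔ negated d
    where
    Atom : D → Set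
    Atom d = Sat J (upd ρ 0 d) (signed s (uat p (var 0)))
    negated : (d : D) → Sat J (upd ρ 0 d) (signed (not s) (uat p (var 0))) ⇔ (¬ Atom d)
    negated d = ¬-cong-⇔ (≡⇒⇔ (sym (Sat-signed J (upd ρ 0 d) s _)))
            ⇔-∘ (Signed-not em s _ ⇔-∘ ≡⇒⇔ (Sat-signed J (upd ρ 0 d) (not s) _))
    deMorgan : ((d : D) → ¬ Sat J (upd ρ 0 d) B ⊎ ¬ Atom d) ⇔ (¬ Σ D λ d → Sat J (upd ρ 0 d) B × Atom d)
    deMorgan = mk⇔ (λ h (d , b , a) → [ (λ ¬b → ¬b b) , (λ ¬a → ¬a a) ]′ (h d)) split
      where
      split : (¬ Σ D λ d → Sat J (upd ρ 0 d) B × Atom d) → (d : D) → ¬ Sat J (upd ρ 0 d) B ⊎ ¬ Atom d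
      split ¬∃ d with em {Sat J (upd ρ 0 d) B}
      ... | yes b = inj₂ λ a → ¬∃ (d , b , a)
      ... | no ¬b = inj₁ ¬b
  Sat-pieceEx-false em ρ clash B = mk⇔ (λ _ ()) (λ _ → tt)

  evalT-fresh : (ρ : Var → D) (t : Term) (d : D) → evalT J (upd ρ (fresh t) d) t ≡ evalT J ρ t
  evalT-fresh ρ (var y) d = upd-≢ ρ d (1+n≢n ∘ sym)
  evalT-fresh ρ (con c) d = refl

  Sat-∃∧-fresh : (ρ : Var → D) (b : Bool) (t : Term) →
    Sat J ρ (pieceF p (∃∧ b (fresh t , eqf (var (fresh t)) t))) ⇔ Signed b (iupr J p (evalT J ρ t) ≡ true)
  Sat-∃∧-fresh ρ b t = mk⇔
    (λ (d , y≡t , s) → subst Holds (trans y≡t (evalT-fresh ρ t d)) (subst id (Sat-signed J _ b _) s))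
    (λ s → evalT J ρ t
         , trans (upd-≡ ρ y _) (sym (evalT-fresh ρ t _))
         , subst id (sym (Sat-signed J _ b _)) (subst Holds (sym (upd-≡ ρ y _)) s))
    where
    y = fresh t
    Holds : D → Set
    Holds v = Signed b (iupr J p v ≡ true)

  Sat-∃type-piece : (ρ : Var → D) (L : List (Bool × UPred)) →
    Sat J ρ (pieceF p (pieceEx true (polarity p L) (typeF (without p L)))) ⇔ Σ D λ d → All (HoldsAt J d) L
  Sat-∃type-piece ρ L =
    Σ-⇔ (λ d → ⇔-sym (HoldsAt-without d L) ⇔-∘ (Sat-typeF ρ d (without p L) ×-⇔ ⇔-id _))
    ⇔-∘ Sat-pieceEx-true ρ (polarity p L) (typeF (without p L))

  Sat-piece : ExcludedMiddle 0ℓ → (ρ : Var → D) (l : Literal) → Sat J ρ (pieceF p (piece p l)) ⇔ SatL J ρ l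
  Sat-piece em ρ (b , nullary q) = Sat-render ρ (b , nullary q)
  Sat-piece em ρ (b , unary q t) with q ≟ p
  ... | yes refl = Sat-∃∧-fresh ρ b t
  ... | no _ = Sat-render ρ (b , unary q t)
  Sat-piece em ρ (true , ∃type L) = Sat-∃type-piece ρ L
  Sat-piece em ρ (false , ∃type L) =
    ¬-cong-⇔ (Sat-∃type-piece ρ L) ⇔-∘ Sat-pieceEx-false em ρ (polarity p L) (typeF (without p L))

module _ {p : UPred} where

  ∃∧-⊑∪ : ∀ b x A → pieceF p (∃∧ b (x , A)) ⊑ exf x A ∪ p
  ∃∧-⊑∪ b x A (ivar y) (y≢x , inj₁ o) = inj₂ (y≢x , o)
  ∃∧-⊑∪ b x A (ivar y) (y≢x , inj₂ o) = ⊥-elim (y≢x (subst id (Occurs-signed (ivar y) b _) o))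
  ∃∧-⊑∪ b x A (const c) (inj₁ o) = inj₂ o
  ∃∧-⊑∪ b x A (const c) (inj₂ o) = ⊥-elim (subst id (Occurs-signed (const c) b _) o)
  ∃∧-⊑∪ b x A (upred q) (inj₁ o) = inj₂ o
  ∃∧-⊑∪ b x A (upred q) (inj₂ o) = inj₁ (cong upred (subst id (Occurs-signed (upred q) b _) o))
  ∃∧-⊑∪ b x A (npred q) (inj₁ o) = inj₂ o
  ∃∧-⊑∪ b x A (npred q) (inj₂ o) = ⊥-elim (subst id (Occurs-signed (npred q) b _) o)

  Occurs-∀∨ : ∀ s b xA → Occurs s (pieceF p (∀∨ b xA)) ≡ Occurs s (pieceF p (∃∧ b xA))
  Occurs-∀∨ (ivar _) b xA = refl
  Occurs-∀∨ (const _) b xA = refl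
  Occurs-∀∨ (upred _) b xA = refl
  Occurs-∀∨ (npred _) b xA = refl

  ∀∨-⊑∪ : ∀ b x A → pieceF p (∀∨ b (x , A)) ⊑ exf x A ∪ p
  ∀∨-⊑∪ b x A s = ∃∧-⊑∪ b x A s ∘ subst id (Occurs-∀∨ s b (x , A))

  pieceEx-⊑∪ : ∀ b π B → pieceF p (pieceEx b π B) ⊑ exf 0 B ∪ p
  pieceEx-⊑∪ true unused B s = inj₂
  pieceEx-⊑∪ false unused B s = inj₂ ∘ subst id (Occurs-neg s _)
  pieceEx-⊑∪ true (only b) B = ∃∧-⊑∪ b 0 B
  pieceEx-⊑∪ false (only b) B s =
    map₂ (exf-mono (λ s → subst id (Occurs-neg s B)) s) ∘ ∀∨-⊑∪ (not b) 0 (neg B) s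
  pieceEx-⊑∪ true clash B s = ⊥-elim ∘ Occurs-ff s
  pieceEx-⊑∪ false clash B s = ⊥-elim ∘ Occurs-tt s

  typeF-without-⊑ : (L : List (Bool × UPred)) → typeF (without p L) ⊑ typeF L
  typeF-without-⊑ [] s o = o
  typeF-without-⊑ ((b , q) ∷ L) with q ≟ p
  ... | yes _ = λ s o → ⊑-andfʳ s (typeF-without-⊑ L s o)
  ... | no _ = andf-⊑ ⊑-andfˡ (λ s o → ⊑-andfʳ s (typeF-without-⊑ L s o))

  eq-atom-⊑∪ : ∀ b y t → pieceF p (∃∧ b (y , eqf (var y) t)) ⊑ signed b (uat p t) ∪ p
  eq-atom-⊑∪ b y t (ivar x) (x≢y , inj₁ (inj₁ x≡y)) = ⊥-elim (x≢y x≡y)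
  eq-atom-⊑∪ b y t (ivar x) (x≢y , inj₁ (inj₂ o)) = inj₂ (subst id (sym (Occurs-signed (ivar x) b _)) o)
  eq-atom-⊑∪ b y t (ivar x) (x≢y , inj₂ o) = ⊥-elim (x≢y (subst id (Occurs-signed (ivar x) b _) o))
  eq-atom-⊑∪ b y t (const c) (inj₁ (inj₂ o)) = inj₂ (subst id (sym (Occurs-signed (const c) b _)) o)
  eq-atom-⊑∪ b y t (const c) (inj₂ o) = ⊥-elim (subst id (Occurs-signed (const c) b _) o)
  eq-atom-⊑∪ b y t (upred q) (inj₂ o) = inj₁ (cong upred (subst id (Occurs-signed (upred q) b _) o))
  eq-atom-⊑∪ b y t (npred q) (inj₂ o) = ⊥-elim (subst id (Occurs-signed (npred q) b _) o)

  piece-⊑∪ : (l : Literal) → pieceF p (piece p l) ⊑ render l ∪ p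
  piece-⊑∪ (b , nullary q) s = inj₂
  piece-⊑∪ (b , unary q t) with q ≟ p
  ... | yes refl = eq-atom-⊑∪ b (fresh t) t
  ... | no _ = λ s → inj₂
  piece-⊑∪ (b , ∃type L) s =
    map₂ (subst id (sym (Occurs-signed s b _)) ∘ exf-mono (typeF-without-⊑ L) s)
    ∘ pieceEx-⊑∪ b (polarity p L) (typeF (without p L)) s

-- The block form

record Parts : Set where
  constructor parts
  field
    plains      : List Fm
    As Bs Cs Ds : List (Var × Fm)

insert : Piece → Parts → Parts
insert (plain G)     (parts gs As Bs Cs Ds) = parts (G ∷ gs) As Bs Cs Ds
insert (∀∨ true A)  (parts gs As Bs Cs Ds) = parts gs (A ∷ As) Bs Cs Ds
insert (∀∨ false B) (parts gs As Bs Cs Ds) = parts gs As (B ∷ Bs) Cs Ds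
insert (∃∧ true C)  (parts gs As Bs Cs Ds) = parts gs As Bs (C ∷ Cs) Ds
insert (∃∧ false D) (parts gs As Bs Cs Ds) = parts gs As Bs Cs (D ∷ Ds)

sortPieces : List Piece → Parts
sortPieces = foldr insert (parts [] [] [] [] [])

partsF : UPred → Parts → Fm
partsF p (parts gs As Bs Cs Ds) = andf (⋀ gs) (Block p As Bs Cs Ds)

AllParts : (Piece → Set) → Parts → Set
AllParts Q (parts gs As Bs Cs Ds) =
  All (Q ∘ plain) gs × All (Q ∘ ∀∨ true) As × All (Q ∘ ∀∨ false) Bs ×
  All (Q ∘ ∃∧ true) Cs × All (Q ∘ ∃∧ false) Ds

module _ {Q : Piece → Set} where

  AllParts-insert : (pc : Piece) (ps : Parts) → (Q pc × AllParts Q ps) ⇔ AllParts Q (insert pc ps)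
  AllParts-insert (plain G) ps = mk⇔
    (λ (q , g , a , b , c , d) → q ∷ g , a , b , c , d) (λ { (q ∷ g , a , b , c , d) → q , g , a , b , c , d })
  AllParts-insert (∀∨ true A) ps = mk⇔
    (λ (q , g , a , b , c , d) → g , q ∷ a , b , c , d) (λ { (g , q ∷ a , b , c , d) → q , g , a , b , c , d })
  AllParts-insert (∀∨ false B) ps = mk⇔
    (λ (q , g , a , b , c , d) → g , a , q ∷ b , c , d) (λ { (g , a , q ∷ b , c , d) → q , g , a , b , c , d })
  AllParts-insert (∃∧ true C) ps = mk⇔
    (λ (q , g , a , b , c , d) → g , a , b , q ∷ c , d) (λ { (g , a , b , q ∷ c , d) → q , g , a , b , c , d })
  AllParts-insert (∃∧ false D) ps = mk⇔
    (λ (q , g , a , b , c , d) → g , a , b , c , q ∷ d) (λ { (g , a , b , c , q ∷ d) → q , g , a , b , c , d })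

  All-sortPieces : (pcs : List Piece) → All Q pcs ⇔ AllParts Q (sortPieces pcs)
  All-sortPieces [] = mk⇔ (λ _ → [] , [] , [] , [] , []) (λ _ → [])
  All-sortPieces (pc ∷ pcs) = AllParts-insert pc (sortPieces pcs) ⇔-∘ mk⇔
    (λ { (q ∷ qs) → q , to (All-sortPieces pcs) qs })
    (λ (q , qs) → q ∷ from (All-sortPieces pcs) qs)

clauseParts : UPred → Clause → Parts
clauseParts p c = sortPieces (map (piece p) c)

blockForm : UPred → Fm → Fm
blockForm p F = ⋁ (map (partsF p ∘ clauseParts p) (dnf F))

-- Block p As Bs Cs Ds is ex2 p (blockBody p As Bs Cs Ds) by definition
blockBody : UPred → (As Bs Cs Ds : List (Var × Fm)) → Fm
blockBody p As Bs Cs Ds =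
  andf (⋀ (map (pieceF p ∘ ∀∨ true) As)) (andf (⋀ (map (pieceF p ∘ ∀∨ false) Bs))
       (andf (⋀ (map (pieceF p ∘ ∃∧ true) Cs)) (⋀ (map (pieceF p ∘ ∃∧ false) Ds))))

Tame : UPred → Fm → Set
Tame p F = ¬ UOcc p F × OnlyQ p F

TamePiece : UPred → Piece → Set
TamePiece p (plain G) = Tame p G
TamePiece p (∀∨ _ (_ , A)) = Tame p A
TamePiece p (∃∧ _ (_ , A)) = Tame p A

OnlyQ-signed : ∀ p b F → OnlyQ p (signed b F) ≡ OnlyQ p F
OnlyQ-signed p true F = refl
OnlyQ-signed p false F = refl

module _ {p : UPred} where

  Tame-signed : ∀ b {F} → Tame p F → Tame p (signed b F)
  Tame-signed b {F} (p∉F , onlyQ) =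
    p∉F ∘ subst id (Occurs-signed (upred p) b F) , subst id (sym (OnlyQ-signed p b F)) onlyQ

  Tame-typeF-without : (L : List (Bool × UPred)) → Tame p (typeF (without p L))
  Tame-typeF-without [] = (λ ()) , tt
  Tame-typeF-without ((b , q) ∷ L) with q ≟ p
  ... | yes _ = Tame-typeF-without L
  ... | no q≢p =
    let (p∉L , onlyQL) = Tame-typeF-without L
        (p∉atom , onlyQatom) = Tame-signed b {uat q (var 0)} ((λ p≡q → q≢p (sym p≡q)) , tt)
    in (λ { (inj₁ o) → p∉atom o ; (inj₂ o) → p∉L o }) , onlyQatom , onlyQL

  TamePiece-pieceEx : ∀ b π {B} → Tame p B → TamePiece p (pieceEx b π B)
  TamePiece-pieceEx true unused t = t
  TamePiece-pieceEx false unused t = t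
  TamePiece-pieceEx true (only s) t = t
  TamePiece-pieceEx false (only s) t = t
  TamePiece-pieceEx true clash t = (λ ()) , tt
  TamePiece-pieceEx false clash t = (λ ()) , tt

  TamePiece-piece : (l : Literal) → TamePiece p (piece p l)
  TamePiece-piece (b , nullary q) = Tame-signed b ((λ ()) , tt)
  TamePiece-piece (b , unary q t) with q ≟ p
  ... | yes _ = (λ ()) , tt
  ... | no q≢p = Tame-signed b ((λ p≡q → q≢p (sym p≡q)) , tt)
  TamePiece-piece (b , ∃type L) = TamePiece-pieceEx b (polarity p L) (Tame-typeF-without L)

  TamePiece-clauseParts : (c : Clause) → AllParts (TamePiece p) (clauseParts p c)
  TamePiece-clauseParts c =
    to (All-sortPieces {TamePiece p} (map (piece p) c)) (Allₚ.map⁺ (All.universal TamePiece-piece c))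

¬UOcc-⋀ : ∀ {p} (Fs : List Fm) → All (λ F → ¬ UOcc p F) Fs → ¬ UOcc p (⋀ Fs)
¬UOcc-⋀ [] [] ()
¬UOcc-⋀ (F ∷ Fs) (p∉F ∷ p∉Fs) (inj₁ o) = p∉F o
¬UOcc-⋀ (F ∷ Fs) (p∉F ∷ p∉Fs) (inj₂ o) = ¬UOcc-⋀ Fs p∉Fs o

plains-p-free : ∀ p (c : Clause) → ¬ UOcc p (⋀ (Parts.plains (clauseParts p c)))
plains-p-free p c = ¬UOcc-⋀ _ (All.map proj₁ (proj₁ (TamePiece-clauseParts c)))

BlockShaped : UPred → Fm → Set
BlockShaped p F = OnlyQ p F × Within p true F

module _ {p : UPred} where

  OnlyQ-⋀ : (Fs : List Fm) → All (OnlyQ p) Fs → OnlyQ p (⋀ Fs)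
  OnlyQ-⋀ [] [] = tt
  OnlyQ-⋀ (F ∷ Fs) (o ∷ os) = o , OnlyQ-⋀ Fs os

  OnlyQ-pieceF : (pc : Piece) → TamePiece p pc → OnlyQ p (pieceF p pc)
  OnlyQ-pieceF (plain G) (_ , o) = o
  OnlyQ-pieceF (∀∨ b (x , A)) (_ , o) = o , subst id (sym (OnlyQ-signed p b _)) tt
  OnlyQ-pieceF (∃∧ b (x , A)) (_ , o) = o , subst id (sym (OnlyQ-signed p b _)) tt

  OnlyQ-⋀-pieces : {X : Set} (k : X → Piece) (xs : List X) → All (TamePiece p ∘ k) xs →
                   OnlyQ p (⋀ (map (pieceF p ∘ k) xs))
  OnlyQ-⋀-pieces k xs t = OnlyQ-⋀ (map (pieceF p ∘ k) xs) (Allₚ.map⁺ (All.map (OnlyQ-pieceF (k _)) t))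

  BlockShaped-partsF : (ps : Parts) → AllParts (TamePiece p) ps → BlockShaped p (partsF p ps)
  BlockShaped-partsF (parts gs As Bs Cs Ds) (g , a , b , c , d) =
    ( OnlyQ-⋀ gs (All.map proj₂ g)
    , refl
    , OnlyQ-⋀-pieces (∀∨ true) As a , OnlyQ-⋀-pieces (∀∨ false) Bs b
    , OnlyQ-⋀-pieces (∃∧ true) Cs c , OnlyQ-⋀-pieces (∃∧ false) Ds d )
    , andf (absent (¬UOcc-⋀ gs (All.map proj₁ g)))
           (block (As , Bs , Cs , Ds , All.map proj₁ a , All.map proj₁ b , All.map proj₁ c , All.map proj₁ d , refl))

  BlockShaped-⋁ : (Fs : List Fm) → All (BlockShaped p) Fs → BlockShaped p (⋁ Fs)
  BlockShaped-⋁ [] [] = tt , absent (λ ())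
  BlockShaped-⋁ (F ∷ Fs) ((o , w) ∷ rest) =
    let (os , ws) = BlockShaped-⋁ Fs rest in (o , os) , orf w ws

  BlockShaped-blockForm : (F : Fm) → BlockShaped p (blockForm p F)
  BlockShaped-blockForm F = BlockShaped-⋁ _ (Allₚ.map⁺ (All.universal
    (λ c → BlockShaped-partsF (clauseParts p c) (TamePiece-clauseParts c)) (dnf F)))

module _ {D : Set} (I : Interp D) (p : UPred) where

  Sat-partsF : (ρ : Var → D) (ps : Parts) → ¬ UOcc p (⋀ (Parts.plains ps)) →
    Sat I ρ (partsF p ps) ⇔ Σ (D → Bool) λ P → AllParts (λ pc → Sat (setU I p P) ρ (pieceF p pc)) ps
  Sat-partsF ρ (parts gs As Bs Cs Ds) p∉gs = mk⇔
    (λ (g , P , b) → P , to (conjuncts P) (g , b))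
    (λ (P , a) → let (g , b) = from (conjuncts P) a in g , P , b)
    where
    conjuncts : (P : D → Bool) → (Sat I ρ (⋀ gs) × Sat (setU I p P) ρ (blockBody p As Bs Cs Ds)) ⇔
                AllParts (λ pc → Sat (setU I p P) ρ (pieceF p pc)) (parts gs As Bs Cs Ds)
    conjuncts P =
      (Sat-⋀ ρ gs ⇔-∘ ⇔-sym (Sat-agreeExcept (setU-agreeExcept I P) (⋀ gs) p∉gs ρ))
      ×-⇔ Sat-⋀-map _ ρ As ×-⇔ Sat-⋀-map _ ρ Bs ×-⇔ Sat-⋀-map _ ρ Cs ×-⇔ Sat-⋀-map _ ρ Ds

  Sat-clauseParts : ExcludedMiddle 0ℓ → (ρ : Var → D) (c : Clause) →
    Sat I ρ (partsF p (clauseParts p c)) ⇔ Σ (D → Bool) λ P → SatC (setU I p P) ρ c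
  Sat-clauseParts em ρ c =
    Σ-⇔ (λ P → All-cong (Sat-piece p em ρ) ⇔-∘ (mk⇔ Allₚ.map⁻ Allₚ.map⁺
               ⇔-∘ ⇔-sym (All-sortPieces {λ pc → Sat (setU I p P) ρ (pieceF p pc)} (map (piece p) c))))
    ⇔-∘ Sat-partsF ρ (clauseParts p c) (plains-p-free p c)

  Sat-blockForm : ExcludedMiddle 0ℓ → (ρ : Var → D) (F : Fm) → MON F →
                  Sat I ρ (blockForm p F) ⇔ Sat I ρ (ex2 p F)
  Sat-blockForm em ρ F m = begin
    Sat I ρ (⋁ (map (partsF p ∘ clauseParts p) (dnf F)))       ∼⟨ Sat-⋁ ρ _ ⟩
    Any (Sat I ρ) (map (partsF p ∘ clauseParts p) (dnf F))       ∼⟨ mk⇔ Anyₚ.map⁻ Anyₚ.map⁺ ⟩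
    Any (λ c → Sat I ρ (partsF p (clauseParts p c))) (dnf F)     ∼⟨ Any-cong (Sat-clauseParts em ρ) ⟩
    Any (λ c → Σ (D → Bool) λ P → SatC (J P) ρ c) (dnf F)        ∼⟨ mk⇔ Anyₚ.Any-Σ⁻ʳ Anyₚ.Any-Σ⁺ʳ ⟩
    (Σ (D → Bool) λ P → SatD (J P) ρ (dnf F))                    ∼⟨ Σ-⇔ (λ P → SatD-dnf em ρ F m) ⟩
    (Σ (D → Bool) λ P → Sat (J P) ρ F)                           ∎
    where
    open EquationalReasoning
    J : (D → Bool) → Interp D
    J = setU I p

module _ {p : UPred} where

  partsF-⊑∪ : ∀ {G} (ps : Parts) → AllParts (λ pc → pieceF p pc ⊑ G ∪ p) ps → partsF p ps ⊑ G ∪ p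
  partsF-⊑∪ {G} (parts gs As Bs Cs Ds) (g , a , b , c , d) =
    andf-⊑∪ (⋀-⊑∪ gs g) (ex2-⊑∪
      (andf-⊑∪ (⋀-pieces (∀∨ true) a) (andf-⊑∪ (⋀-pieces (∀∨ false) b)
      (andf-⊑∪ (⋀-pieces (∃∧ true) c) (⋀-pieces (∃∧ false) d)))))
    where
    ⋀-pieces : {X : Set} (k : X → Piece) {xs : List X} →
               All (λ x → pieceF p (k x) ⊑ G ∪ p) xs → ⋀ (map (pieceF p ∘ k) xs) ⊑ G ∪ p
    ⋀-pieces k a = ⋀-⊑∪ _ (Allₚ.map⁺ a)

  blockForm-⊑∪ : (F : Fm) → blockForm p F ⊑ F ∪ p
  blockForm-⊑∪ F = ⋁-⊑∪ _ (Allₚ.map⁺ (All.map clause (dnf-⊑ᴰ F)))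
    where
    clause : ∀ {c} → All (λ l → render l ⊑ F) c → partsF p (clauseParts p c) ⊑ F ∪ p
    clause {c} c⊑F = partsF-⊑∪ (clauseParts p c)
      (to (All-sortPieces {λ pc → pieceF p pc ⊑ F ∪ p} (map (piece p) c))
          (Allₚ.map⁺ (All.map (λ {l} → ⊑∪-trans (piece-⊑∪ l)) c⊑F)))

⊑∪-absorb : ∀ {p F G} → F ⊑ G ∪ p → UOcc p G → F ⊑ G
⊑∪-absorb F⊑G p∈G s o = [ (λ { refl → p∈G }) , id ]′ (F⊑G s o)

UOcc? : (p : UPred) (F : Fm) → Dec (UOcc p F)
UOcc? p tt = no λ ()
UOcc? p ff = no λ ()
UOcc? p (nat _) = no λ ()
UOcc? p (uat q _) = p ≟ q
UOcc? p (eqf _ _) = no λ ()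
UOcc? p (neg F) = UOcc? p F
UOcc? p (andf F G) = UOcc? p F ⊎-dec UOcc? p G
UOcc? p (orf F G) = UOcc? p F ⊎-dec UOcc? p G
UOcc? p (allf _ F) = UOcc? p F
UOcc? p (exf _ F) = UOcc? p F
UOcc? p (all2 q F) = (p ≟ q) ⊎-dec UOcc? p F
UOcc? p (ex2 q F) = (p ≟ q) ⊎-dec UOcc? p F

OnlyQ-MON : ∀ p F → MON F → OnlyQ p F
OnlyQ-MON p tt _ = tt
OnlyQ-MON p ff _ = tt
OnlyQ-MON p (nat _) _ = tt
OnlyQ-MON p (uat _ _) _ = tt
OnlyQ-MON p (neg F) m = OnlyQ-MON p F m
OnlyQ-MON p (andf F G) (mF , mG) = OnlyQ-MON p F mF , OnlyQ-MON p G mG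
OnlyQ-MON p (orf F G) (mF , mG) = OnlyQ-MON p F mF , OnlyQ-MON p G mG
OnlyQ-MON p (allf _ F) m = OnlyQ-MON p F m
OnlyQ-MON p (exf _ F) m = OnlyQ-MON p F m

Sat-ex2-unused : {D : Set} (I : Interp D) (ρ : Var → D) {p : UPred} (F : Fm) → ¬ UOcc p F →
                 Sat I ρ F ⇔ Sat I ρ (ex2 p F)
Sat-ex2-unused {D} I ρ {p} F p∉F = mk⇔
  (λ s → (λ _ → true) , from (coincide (λ _ → true)) s)
  (λ (P , s) → to (coincide P) s)
  where
  coincide : (P : D → Bool) → Sat (setU I p P) ρ F ⇔ Sat I ρ F
  coincide P = Sat-agreeExcept (setU-agreeExcept I P) F p∉F ρ

⇔⇒Equiv : (F G : Fm) → (∀ D (I : Interp D) ρ → Sat I ρ F ⇔ Sat I ρ G) → Equiv F G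
⇔⇒Equiv F G F⇔G D I ρ = to (F⇔G D I ρ) , from (F⇔G D I ρ)

-- The block form always mentions p, which condition (5) forbids when F does not; then ∃p F ≡ F.
eliminate : UPred → Fm → Fm
eliminate p F with UOcc? p F
... | yes _ = blockForm p F
... | no _ = F

eliminate-correct : (p : UPred) (F : Fm) → MON F →
  (ExcludedMiddle 0ℓ → Equiv (eliminate p F) (ex2 p F)) × BlockShaped p (eliminate p F) × eliminate p F ⊑ F
eliminate-correct p F m with UOcc? p F
... | yes p∈F = (λ em → ⇔⇒Equiv _ (ex2 p F) λ D I ρ → Sat-blockForm I p em ρ F m)
              , BlockShaped-blockForm F , ⊑∪-absorb (blockForm-⊑∪ F) p∈F
... | no p∉F = (λ em → ⇔⇒Equiv F (ex2 p F) λ D I ρ → Sat-ex2-unused I ρ F p∉F)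
             , (OnlyQ-MON p F m , absent p∉F) , (λ s o → o)

lemma6 : Σ (UPred → Fm → Fm) λ elim →
           (p : UPred) (F : Fm) → MON F →
           (ExcludedMiddle 0ℓ → Equiv (elim p F) (ex2 p F))
           × OnlyQ p (elim p F)
           × Within p true (elim p F)
           × ((x : Var) → Free x (elim p F) → Free x F)
           × ((c : Const) → COcc c (elim p F) → COcc c F)
           × ((q : UPred) → UOcc q (elim p F) → UOcc q F)
           × ((q : NPred) → NOcc q (elim p F) → NOcc q F)
lemma6 = eliminate , λ p F m →
  let (equiv , (onlyQ , within) , symbols) = eliminate-correct p F m
  in equiv , onlyQ , within , symbols ∘ ivar , symbols ∘ const , symbols ∘ upred , symbols ∘ npred
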